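{- Let $H$ be a graph, let $m,n$ be integers with $3 \le m < n$, and let $k$ be a positive integer. Suppose there is a star $k$-edge-coloring of $C_n \,\square\, H$ that includes a star edge-coloring of $C_m \,\square\, H$. Then for every pair of non-negative integers $p$ and $q$, not both zero, we have $\chi'_{st}(C_{p\cdot m + q\cdot n} \,\square\, H) \le k$.
   Context: A star edge-coloring of a graph $G$ is a proper edge-coloring of $G$ in which there is no bichromatic path and no bichromatic cycle of length four (i.e., with four edges); a star $k$-edge-coloring is one using at most $k$ colors. The star chromatic index $\chi'_{st}(G)$ is the minimum number of colors in a star edge-coloring of $G$. $C_m$ denotes the cycle on $m$ vertices. $G \,\square\, H$ denotes the Cartesian product: vertex set $V(G)\times V(H)$, with $(u,v)(u',v')$ an edge iff either $uu'\in E(G)$ and $v=v'$, or $u=u'$ and $vv'\in E(H)$. For $u\in V(C_n)$, the $H$-fiber $H_u$ is the subgraph induced by $\{(u,w): w\in V(H)\}$. Let $C_n = v_1v_2\dots v_nv_1$. A star edge-coloring $\sigma$ of $C_n\,\square\, H$ is said to include a star edge-coloring of $C_m\,\square\, H$ (for $3\le m<n$) if the following coloring $\sigma^*$ is a star edge-coloring: $\sigma^*$ is defined on the subgraph induced by the vertices of the $m$ consecutive $H$-fibers $H_{v_1},\dots,H_{v_m}$ together with the additional edges $e_w=(v_1,w)(v_m,w)$ for all $w\in V(H)$ (this graph is a copy of $C_m\,\square\, H$), where $\sigma^*$ agrees with $\sigma$ on the induced subgraph and $\sigma^*(e_w)=\sigma((v_1,w)(v_n,w))$. -}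

module Defs where

open import Data.Nat using (ℕ; zero; suc; _≤_; _<_; _∸_; _+_; _*_; z≤n; s≤s)
open import Data.Nat.Properties using (_≟_)
open import Data.Fin using (Fin; toℕ; inject≤; fromℕ)
open import Data.Product using (_×_; _,_; ∃; ∃-syntax)
open import Data.Sum using (_⊎_)
open import Data.Bool using (Bool; true; false; _∧_; _∨_; if_then_else_)
open import Relation.Nullary using (¬_)
open import Relation.Nullary.Decidable using (⌊_⌋)
open import Relation.Binary.PropositionalEquality using (_≡_; _≢_)

record Graph (V : Set) : Set₁ where
  field
    Adj   : V → V → Set
    sym   : ∀ {u v} → Adj u v → Adj v u
    irrefl : ∀ {u} → ¬ Adj u u
open Graph public

FinGraph : ℕ → Set₁
FinGraph h = Graph (Fin h)

-- Cycle C_m on vertices 0,…,m-1 (v_{i+1} is represented by i), edges i~i+1 and 0~(m-1).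
-- Meaningful (simple) for m ≥ 3.
CycAdjℕ : ℕ → ℕ → ℕ → Set
CycAdjℕ m a b = (suc a ≡ b) ⊎ (suc b ≡ a) ⊎ ((a ≡ 0) × (suc b ≡ m)) ⊎ ((b ≡ 0) × (suc a ≡ m))

CycProdAdj : (m : ℕ) → {V : Set} → Graph V → (Fin m × V) → (Fin m × V) → Set
CycProdAdj m H (i , w) (j , w') =
  (CycAdjℕ m (toℕ i) (toℕ j) × w ≡ w') ⊎ (i ≡ j × Adj H w w')

-- An edge-coloring with colors in Fin k: a symmetric color assignment on adjacent pairs
-- (values on non-adjacent pairs are irrelevant).
EdgeColoring : (V : Set) → ℕ → Set
EdgeColoring V k = V → V → Fin k

module _ {V : Set} (Adj : V → V → Set) {k : ℕ} (c : EdgeColoring V k) where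

  Symmetric : Set
  Symmetric = ∀ {u v} → Adj u v → c u v ≡ c v u

  Proper : Set
  Proper = ∀ {u v w} → Adj u v → Adj u w → v ≢ w → c u v ≢ c u w

  Bichromatic4 : Fin k → Fin k → Fin k → Fin k → Set
  Bichromatic4 x y z t = ∃[ a ] ∃[ b ]
    ((x ≡ a ⊎ x ≡ b) × (y ≡ a ⊎ y ≡ b) × (z ≡ a ⊎ z ≡ b) × (t ≡ a ⊎ t ≡ b))

  NoBichromaticP4 : Set
  NoBichromaticP4 = ∀ {v0 v1 v2 v3 v4} →
    v0 ≢ v1 → v0 ≢ v2 → v0 ≢ v3 → v0 ≢ v4 → v1 ≢ v2 → v1 ≢ v3 → v1 ≢ v4 →
    v2 ≢ v3 → v2 ≢ v4 → v3 ≢ v4 →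
    Adj v0 v1 → Adj v1 v2 → Adj v2 v3 → Adj v3 v4 →
    ¬ Bichromatic4 (c v0 v1) (c v1 v2) (c v2 v3) (c v3 v4)

  NoBichromaticC4 : Set
  NoBichromaticC4 = ∀ {v0 v1 v2 v3} →
    v0 ≢ v1 → v0 ≢ v2 → v0 ≢ v3 → v1 ≢ v2 → v1 ≢ v3 → v2 ≢ v3 →
    Adj v0 v1 → Adj v1 v2 → Adj v2 v3 → Adj v3 v0 →
    ¬ Bichromatic4 (c v0 v1) (c v1 v2) (c v2 v3) (c v3 v0)

  record IsStarEdgeColoring : Set where
    field
      symmetric : Symmetric
      proper    : Proper
      noP4      : NoBichromaticP4
      noC4      : NoBichromaticC4

StarColorableCycProd : (N : ℕ) → {V : Set} → Graph V → ℕ → Set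
StarColorableCycProd N H k =
  ∃[ c ] IsStarEdgeColoring (CycProdAdj N H) {k} c

-- The coloring σ* on C_m □ H induced by σ on C_n □ H (m < n):
-- on the wrap-around edges (v_1,w)(v_m,w) it takes the color σ((v_1,w)(v_n,w)),
-- elsewhere it agrees with σ on the first m fibers.
isWrap : ℕ → ℕ → ℕ → Bool
isWrap m a b = (⌊ a ≟ 0 ⌋ ∧ ⌊ b ≟ m ∸ 1 ⌋) ∨ (⌊ b ≟ 0 ⌋ ∧ ⌊ a ≟ m ∸ 1 ⌋)

restrictColoring : {V : Set} {k : ℕ} (m n : ℕ) → m < n →
  EdgeColoring (Fin n × V) k → EdgeColoring (Fin m × V) k
restrictColoring {V} {k} m (suc n') m<n σ (i , w) (j , w') =
  if isWrap m (toℕ i) (toℕ j)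
  then wrapCol (toℕ i) w w'
  else σ (inject≤ i m≤n , w) (inject≤ j m≤n , w')
  where
    m≤n : m ≤ suc n'
    m≤n = Data.Nat.Properties.<⇒≤ m<n
    -- the v_1 endpoint is the one whose index is 0
    wrapCol : ℕ → V → V → Fin k
    wrapCol zero    x y = σ (Fin.zero , x) (fromℕ n' , y)
    wrapCol (suc _) x y = σ (fromℕ n' , x) (Fin.zero , y)

Includes : {V : Set} {k : ℕ} (H : Graph V) (m n : ℕ) → m < n →
  EdgeColoring (Fin n × V) k → Set
Includes H m n m<n σ = IsStarEdgeColoring (CycProdAdj m H) (restrictColoring m n m<n σ)

module Submission where

-- Cut C_N, N = p·m + q·n, into p blocks of length m and q blocks of length n, and label
-- every position by its index inside its block. An edge of C_N □ H then corresponds to an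
-- edge of C_n □ H and gets the color σ gives that edge, except for the edge leaving an
-- m-block (labels m - 1 → 0): it has no counterpart in C_n and gets the color that σ*
-- gives to the wrap-around edge of C_m □ H.
-- A proper coloring is star exactly when it has no alternating walk w₀ … w₄ and no
-- alternating closed walk w₀ … w₃ that never immediately backtracks (with decidable
-- equality, a repeated vertex yields a properness violation or a bichromatic 4-cycle).
-- Such a walk in C_N □ H avoiding the m-block edges maps label by label onto one in
-- C_n □ H. One using such an edge stays in a window around it where all labels are below
-- m, and maps onto one in C_m □ H. In the single exception (m = 3, the walk reaching
-- label 3 of an n-block) its first three edges map onto a triangle of C_3 □ H with two
-- equally colored edges at a vertex.

open import Defs hiding (sym; irrefl)
open import Data.Bool using (true; false; _∧_; _∨_; T)
open import Data.Empty using (⊥)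
open import Data.Fin using (Fin; toℕ; fromℕ; fromℕ<; inject≤) renaming (zero to fzero; _≟_ to _≟ᶠ_)
open import Data.Fin.Properties using (toℕ-injective; toℕ-fromℕ<; toℕ-fromℕ; toℕ-inject≤; toℕ<n)
open import Data.List using (List; []; _∷_; _++_; replicate)
open import Data.List.Relation.Unary.All using (All; []; _∷_)
open import Data.List.Relation.Unary.All.Properties using (++⁺; replicate⁺)
open import Data.Nat using (ℕ; zero; suc; pred; _≤_; _<_; _∸_; _+_; _*_; _⊓_; _≤ᵇ_; z≤n; s≤s; z<s)
open import Data.Nat.ListAction using (sum)
open import Data.Nat.ListAction.Properties using (sum-++)
open import Data.Nat.Properties
open import Data.Product using (_×_; _,_; proj₁; proj₂; ∃-syntax)
open import Data.Product.Properties using (≡-dec)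
open import Data.Sum using (_⊎_; inj₁; inj₂; [_,_]′)
open import Function using (_∘_)
open import Relation.Binary.Definitions using (DecidableEquality)
open import Relation.Binary.PropositionalEquality
open import Relation.Nullary using (¬_; yes; no; does; contradiction)
open import Relation.Nullary.Decidable using (Dec; _×-dec_; _⊎-dec_; dec-true; dec-false; isYes≗does)

-- Alternating walks

record AlternatingWalk {V : Set} (Adj : V → V → Set) {k : ℕ} (c : EdgeColoring V k) : Set where
  field
    {w₀ w₁ w₂ w₃ w₄} : V
    a₀₁ : Adj w₀ w₁
    a₁₂ : Adj w₁ w₂
    a₂₃ : Adj w₂ w₃
    a₃₄ : Adj w₃ w₄
    w₀≢w₂ : w₀ ≢ w₂
    w₁≢w₃ : w₁ ≢ w₃
    w₂≢w₄ : w₂ ≢ w₄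
    c₀₁≡c₂₃ : c w₀ w₁ ≡ c w₂ w₃
    c₁₂≡c₃₄ : c w₁ w₂ ≡ c w₃ w₄

record AlternatingClosedWalk {V : Set} (Adj : V → V → Set) {k : ℕ} (c : EdgeColoring V k) : Set where
  field
    {w₀ w₁ w₂ w₃} : V
    a₀₁ : Adj w₀ w₁
    a₁₂ : Adj w₁ w₂
    a₂₃ : Adj w₂ w₃
    a₃₀ : Adj w₃ w₀
    w₀≢w₂ : w₀ ≢ w₂
    w₁≢w₃ : w₁ ≢ w₃
    c₀₁≡c₂₃ : c w₀ w₁ ≡ c w₂ w₃
    c₁₂≡c₃₀ : c w₁ w₂ ≡ c w₃ w₀

record EdgeImage {V V′ : Set} {k : ℕ} (Adj′ : V′ → V′ → Set) (c′ : EdgeColoring V′ k)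
                 (c : EdgeColoring V k) (f : V → V′) (u v : V) : Set where
  constructor edgeImage
  field
    adjacent : Adj′ (f u) (f v)
    color    : c′ (f u) (f v) ≡ c u v
open EdgeImage

module _ {V V′ : Set} {Adj′ : V′ → V′ → Set} {k : ℕ} {c : EdgeColoring V k} {c′ : EdgeColoring V′ k}
         (f : V → V′) where

  private
    Image : V → V → Set
    Image = EdgeImage Adj′ c′ c f

  image-symmetric : Symmetric Adj′ c′ → ∀ {u v} → Image u v → Image v u → c u v ≡ c v u
  image-symmetric c′-sym (edgeImage a e) (edgeImage _ e′) = trans (sym e) (trans (c′-sym a) e′)

  image-proper : Proper Adj′ c′ → ∀ {u v z} → Image u v → Image u z → f v ≢ f z → c u v ≢ c u z
  image-proper c′-proper (edgeImage a e) (edgeImage a′ e′) fv≢fz c≡ = c′-proper a a′ fv≢fz (trans e (trans c≡ (sym e′)))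

  module _ {Adj : V → V → Set} where

    mapWalk : (W : AlternatingWalk Adj c) → let open AlternatingWalk W in
              Image w₀ w₁ → Image w₁ w₂ → Image w₂ w₃ → Image w₃ w₄ →
              f w₀ ≢ f w₂ → f w₁ ≢ f w₃ → f w₂ ≢ f w₄ → AlternatingWalk Adj′ c′
    mapWalk W (edgeImage a₀₁ e₀₁) (edgeImage a₁₂ e₁₂) (edgeImage a₂₃ e₂₃) (edgeImage a₃₄ e₃₄) n₀₂ n₁₃ n₂₄ = record
      { a₀₁ = a₀₁ ; a₁₂ = a₁₂ ; a₂₃ = a₂₃ ; a₃₄ = a₃₄
      ; w₀≢w₂ = n₀₂ ; w₁≢w₃ = n₁₃ ; w₂≢w₄ = n₂₄
      ; c₀₁≡c₂₃ = trans e₀₁ (trans (AlternatingWalk.c₀₁≡c₂₃ W) (sym e₂₃))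
      ; c₁₂≡c₃₄ = trans e₁₂ (trans (AlternatingWalk.c₁₂≡c₃₄ W) (sym e₃₄)) }

    mapClosedWalk : (W : AlternatingClosedWalk Adj c) → let open AlternatingClosedWalk W in
                    Image w₀ w₁ → Image w₁ w₂ → Image w₂ w₃ → Image w₃ w₀ →
                    f w₀ ≢ f w₂ → f w₁ ≢ f w₃ → AlternatingClosedWalk Adj′ c′
    mapClosedWalk W (edgeImage a₀₁ e₀₁) (edgeImage a₁₂ e₁₂) (edgeImage a₂₃ e₂₃) (edgeImage a₃₀ e₃₀) n₀₂ n₁₃ = record
      { a₀₁ = a₀₁ ; a₁₂ = a₁₂ ; a₂₃ = a₂₃ ; a₃₀ = a₃₀
      ; w₀≢w₂ = n₀₂ ; w₁≢w₃ = n₁₃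
      ; c₀₁≡c₂₃ = trans e₀₁ (trans (AlternatingClosedWalk.c₀₁≡c₂₃ W) (sym e₂₃))
      ; c₁₂≡c₃₀ = trans e₁₂ (trans (AlternatingClosedWalk.c₁₂≡c₃₀ W) (sym e₃₀)) }

module _ {V : Set} {Adj : V → V → Set} {k : ℕ} {c : EdgeColoring V k} where

  rotate : AlternatingClosedWalk Adj c → AlternatingClosedWalk Adj c
  rotate W = record
    { a₀₁ = a₁₂ ; a₁₂ = a₂₃ ; a₂₃ = a₃₀ ; a₃₀ = a₀₁
    ; w₀≢w₂ = w₁≢w₃ ; w₁≢w₃ = λ e → w₀≢w₂ (sym e)
    ; c₀₁≡c₂₃ = c₁₂≡c₃₀ ; c₁₂≡c₃₀ = sym c₀₁≡c₂₃ }
    where open AlternatingClosedWalk W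

  module _ (adj-sym : ∀ {u v} → Adj u v → Adj v u) (c-sym : Symmetric Adj c) where

    reverse : AlternatingWalk Adj c → AlternatingWalk Adj c
    reverse W = record
      { a₀₁ = adj-sym a₃₄ ; a₁₂ = adj-sym a₂₃ ; a₂₃ = adj-sym a₁₂ ; a₃₄ = adj-sym a₀₁
      ; w₀≢w₂ = λ e → w₂≢w₄ (sym e) ; w₁≢w₃ = λ e → w₁≢w₃ (sym e) ; w₂≢w₄ = λ e → w₀≢w₂ (sym e)
      ; c₀₁≡c₂₃ = trans (sym (c-sym a₃₄)) (trans (sym c₁₂≡c₃₄) (c-sym a₁₂))
      ; c₁₂≡c₃₄ = trans (sym (c-sym a₂₃)) (trans (sym c₀₁≡c₂₃) (c-sym a₀₁)) }
      where open AlternatingWalk W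

    reverseClosed : AlternatingClosedWalk Adj c → AlternatingClosedWalk Adj c
    reverseClosed W = record
      { a₀₁ = adj-sym a₃₀ ; a₁₂ = adj-sym a₂₃ ; a₂₃ = adj-sym a₁₂ ; a₃₀ = adj-sym a₀₁
      ; w₀≢w₂ = w₀≢w₂ ; w₁≢w₃ = λ e → w₁≢w₃ (sym e)
      ; c₀₁≡c₂₃ = trans (sym (c-sym a₃₀)) (trans (sym c₁₂≡c₃₀) (c-sym a₁₂))
      ; c₁₂≡c₃₀ = trans (sym (c-sym a₂₃)) (trans (sym c₀₁≡c₂₃) (c-sym a₀₁)) }
      where open AlternatingClosedWalk W

    module _ (proper : Proper Adj c) where

      private
        alternating : ∀ {x y z t : Fin k} → x ≢ y → y ≢ z → z ≢ t →
                      Bichromatic4 Adj c x y z t → x ≡ z × y ≡ t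
        alternating x≢y y≢z z≢t (_ , _ , ex , ey , ez , et) = go ex ey ez et
          where
          go : _ → _ → _ → _ → _
          go (inj₁ refl) (inj₁ refl) _ _ = contradiction refl x≢y
          go (inj₂ refl) (inj₂ refl) _ _ = contradiction refl x≢y
          go _ (inj₁ refl) (inj₁ refl) _ = contradiction refl y≢z
          go _ (inj₂ refl) (inj₂ refl) _ = contradiction refl y≢z
          go _ _ (inj₁ refl) (inj₁ refl) = contradiction refl z≢t
          go _ _ (inj₂ refl) (inj₂ refl) = contradiction refl z≢t
          go (inj₁ refl) (inj₂ refl) (inj₁ refl) (inj₂ refl) = refl , refl
          go (inj₂ refl) (inj₁ refl) (inj₂ refl) (inj₁ refl) = refl , refl

        consecutive-≢ : ∀ {u v w} → Adj u v → Adj v w → u ≢ w → c u v ≢ c v w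
        consecutive-≢ a b u≢w e = proper (adj-sym a) b u≢w (trans (sym (c-sym a)) e)

      star-if-no-alternating : ¬ AlternatingWalk Adj c → ¬ AlternatingClosedWalk Adj c →
                               IsStarEdgeColoring Adj c
      star-if-no-alternating noWalk noClosedWalk = record
        { symmetric = c-sym ; proper = proper ; noP4 = noP4 ; noC4 = noC4 }
        where
        noP4 : NoBichromaticP4 Adj c
        noP4 _ v₀≢v₂ _ _ _ v₁≢v₃ _ _ v₂≢v₄ _ a₀₁ a₁₂ a₂₃ a₃₄ bichromatic
          with alternating (consecutive-≢ a₀₁ a₁₂ v₀≢v₂) (consecutive-≢ a₁₂ a₂₃ v₁≢v₃)
                           (consecutive-≢ a₂₃ a₃₄ v₂≢v₄) bichromatic
        ... | c₀₂ , c₁₃ = noWalk (record { a₀₁ = a₀₁ ; a₁₂ = a₁₂ ; a₂₃ = a₂₃ ; a₃₄ = a₃₄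
                                         ; w₀≢w₂ = v₀≢v₂ ; w₁≢w₃ = v₁≢v₃ ; w₂≢w₄ = v₂≢v₄
                                         ; c₀₁≡c₂₃ = c₀₂ ; c₁₂≡c₃₄ = c₁₃ })
        noC4 : NoBichromaticC4 Adj c
        noC4 _ v₀≢v₂ _ _ v₁≢v₃ _ a₀₁ a₁₂ a₂₃ a₃₀ bichromatic
          with alternating (consecutive-≢ a₀₁ a₁₂ v₀≢v₂) (consecutive-≢ a₁₂ a₂₃ v₁≢v₃)
                           (consecutive-≢ a₂₃ a₃₀ (λ e → v₀≢v₂ (sym e))) bichromatic
        ... | c₀₂ , c₁₃ = noClosedWalk (record { a₀₁ = a₀₁ ; a₁₂ = a₁₂ ; a₂₃ = a₂₃ ; a₃₀ = a₃₀
                                               ; w₀≢w₂ = v₀≢v₂ ; w₁≢w₃ = v₁≢v₃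
                                               ; c₀₁≡c₂₃ = c₀₂ ; c₁₂≡c₃₀ = c₁₃ })

module StarColoringWalks {V : Set} {Adj : V → V → Set} (_≟_ : DecidableEquality V)
                         (adj-irrefl : ∀ {u} → ¬ Adj u u) (adj-sym : ∀ {u v} → Adj u v → Adj v u)
                         {k : ℕ} {c : EdgeColoring V k} (star : IsStarEdgeColoring Adj c) where
  open IsStarEdgeColoring star

  adj⇒≢ : ∀ {u v} → Adj u v → u ≢ v
  adj⇒≢ a refl = adj-irrefl a

  triangle-colors : ∀ {w₀ w₁ w₂ w₃} → Adj w₀ w₁ → Adj w₁ w₂ → Adj w₂ w₃ → w₀ ≡ w₃ →
                    c w₀ w₁ ≢ c w₂ w₃
  triangle-colors a₀₁ a₁₂ a₂₃ refl e = proper a₀₁ (adj-sym a₂₃) (adj⇒≢ a₁₂) (trans e (symmetric a₂₃))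

  private
    twoColors : ∀ {x y z t} → x ≡ z → y ≡ t → Bichromatic4 Adj c x y z t
    twoColors {x} {y} refl refl = x , y , inj₁ refl , inj₂ refl , inj₁ refl , inj₂ refl

  no-alternatingWalk : ¬ AlternatingWalk Adj c
  no-alternatingWalk W = go
    where
    open AlternatingWalk W
    go : ⊥
    go with w₀ ≟ w₃ | w₁ ≟ w₄ | w₀ ≟ w₄
    ... | yes w₀≡w₃ | _ | _ = triangle-colors a₀₁ a₁₂ a₂₃ w₀≡w₃ c₀₁≡c₂₃
    ... | no _ | yes w₁≡w₄ | _ = triangle-colors a₁₂ a₂₃ a₃₄ w₁≡w₄ c₁₂≡c₃₄
    ... | no w₀≢w₃ | no _ | yes refl =
      noC4 (adj⇒≢ a₀₁) w₀≢w₂ w₀≢w₃ (adj⇒≢ a₁₂) w₁≢w₃ (adj⇒≢ a₂₃) a₀₁ a₁₂ a₂₃ a₃₄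
           (twoColors c₀₁≡c₂₃ c₁₂≡c₃₄)
    ... | no w₀≢w₃ | no w₁≢w₄ | no w₀≢w₄ =
      noP4 (adj⇒≢ a₀₁) w₀≢w₂ w₀≢w₃ w₀≢w₄ (adj⇒≢ a₁₂) w₁≢w₃ w₁≢w₄ (adj⇒≢ a₂₃) w₂≢w₄ (adj⇒≢ a₃₄)
           a₀₁ a₁₂ a₂₃ a₃₄ (twoColors c₀₁≡c₂₃ c₁₂≡c₃₄)

  no-alternatingClosedWalk : ¬ AlternatingClosedWalk Adj c
  no-alternatingClosedWalk W =
    noC4 (adj⇒≢ a₀₁) w₀≢w₂ (λ e → adj⇒≢ a₃₀ (sym e)) (adj⇒≢ a₁₂) w₁≢w₃ (adj⇒≢ a₂₃)
         a₀₁ a₁₂ a₂₃ a₃₀ (twoColors c₀₁≡c₂₃ c₁₂≡c₃₀)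
    where open AlternatingClosedWalk W

-- Cycles and block labellings

cycAdj-sym : ∀ {M i j} → CycAdjℕ M i j → CycAdjℕ M j i
cycAdj-sym (inj₁ e)               = inj₂ (inj₁ e)
cycAdj-sym (inj₂ (inj₁ e))        = inj₁ e
cycAdj-sym (inj₂ (inj₂ (inj₁ e))) = inj₂ (inj₂ (inj₂ e))
cycAdj-sym (inj₂ (inj₂ (inj₂ e))) = inj₂ (inj₂ (inj₁ e))

module _ {V : Set} (H : Graph V) where

  cycProd-sym : ∀ {M u v} → CycProdAdj M H u v → CycProdAdj M H v u
  cycProd-sym (inj₁ (inj₁ e , w≡w′))               = inj₁ (inj₂ (inj₁ e) , sym w≡w′)
  cycProd-sym (inj₁ (inj₂ (inj₁ e) , w≡w′))        = inj₁ (inj₁ e , sym w≡w′)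
  cycProd-sym (inj₁ (inj₂ (inj₂ (inj₁ e)) , w≡w′)) = inj₁ (inj₂ (inj₂ (inj₂ e)) , sym w≡w′)
  cycProd-sym (inj₁ (inj₂ (inj₂ (inj₂ e)) , w≡w′)) = inj₁ (inj₂ (inj₂ (inj₁ e)) , sym w≡w′)
  cycProd-sym (inj₂ (i≡j , a))                     = inj₂ (sym i≡j , Graph.sym H a)

  cycProd-irrefl : ∀ {M} → 2 ≤ M → ∀ {u} → ¬ CycProdAdj M H u u
  cycProd-irrefl _   (inj₁ (inj₁ e , _))                        = 1+n≢n e
  cycProd-irrefl _   (inj₁ (inj₂ (inj₁ e) , _))                 = 1+n≢n e
  cycProd-irrefl 2≤M (inj₁ (inj₂ (inj₂ (inj₁ (i≡0 , e))) , _)) =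
    <⇒≱ 2≤M (≤-reflexive (trans (sym e) (cong suc i≡0)))
  cycProd-irrefl 2≤M (inj₁ (inj₂ (inj₂ (inj₂ (i≡0 , e))) , _)) =
    <⇒≱ 2≤M (≤-reflexive (trans (sym e) (cong suc i≡0)))
  cycProd-irrefl _   (inj₂ (_ , a))                             = Graph.irrefl H a

module CyclicOrder (N₁ : ℕ) where

  -- Abstract: normalising `next` on open terms makes type checking very slow.
  abstract
    next : ℕ → ℕ
    next x with x ≟ N₁
    ... | yes _ = 0
    ... | no  _ = suc x

    next-< : ∀ {x} → x < N₁ → next x ≡ suc x
    next-< {x} x<N₁ with x ≟ N₁
    ... | yes refl = contradiction x<N₁ (<-irrefl refl)
    ... | no  _    = refl

    next-last : next N₁ ≡ 0
    next-last with N₁ ≟ N₁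
    ... | yes _   = refl
    ... | no  N₁≢ = contradiction refl N₁≢

    next-≤ : ∀ {x} → x ≤ N₁ → next x ≤ N₁
    next-≤ {x} x≤N₁ with x ≟ N₁
    ... | yes _   = z≤n
    ... | no  x≢N₁ = ≤∧≢⇒< x≤N₁ x≢N₁

    next-injective : ∀ {x y} → next x ≡ next y → x ≡ y
    next-injective {x} {y} e with x ≟ N₁ | y ≟ N₁
    ... | yes x≡N₁ | yes y≡N₁ = trans x≡N₁ (sym y≡N₁)
    ... | yes _    | no  _    = contradiction e λ ()
    ... | no  _    | yes _    = contradiction e λ ()
    ... | no  _    | no  _    = suc-injective e

  prev : ℕ → ℕ
  prev zero    = N₁
  prev (suc x) = x

  prev-≤ : ∀ {x} → x ≤ N₁ → prev x ≤ N₁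
  prev-≤ {zero}  _   = ≤-refl
  prev-≤ {suc x} x<N₁ = <⇒≤ x<N₁

  next-prev : ∀ {x} → x ≤ N₁ → next (prev x) ≡ x
  next-prev {zero}  _    = next-last
  next-prev {suc x} x<N₁ = next-< x<N₁

  cycAdj⇒next : ∀ {x y} → x ≤ N₁ → y ≤ N₁ → CycAdjℕ (suc N₁) x y → y ≡ next x ⊎ x ≡ next y
  cycAdj⇒next _ y≤N₁ (inj₁ refl)       = inj₁ (sym (next-< y≤N₁))
  cycAdj⇒next x≤N₁ _ (inj₂ (inj₁ refl)) = inj₂ (sym (next-< x≤N₁))
  cycAdj⇒next _ _ (inj₂ (inj₂ (inj₁ (x≡0 , refl)))) = inj₂ (trans x≡0 (sym next-last))
  cycAdj⇒next _ _ (inj₂ (inj₂ (inj₂ (y≡0 , refl)))) = inj₁ (trans y≡0 (sym next-last))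

module BlockLabelling (m₁ n₁ : ℕ) (m₁≤n₁ : m₁ ≤ n₁) where

  NextLabel : ℕ → ℕ → Set
  NextLabel i j = (j ≡ suc i × j ≤ n₁) ⊎ (j ≡ 0 × (i ≡ m₁ ⊎ i ≡ n₁))

  Block : ℕ → Set
  Block b = b ≡ suc m₁ ⊎ b ≡ suc n₁

  label : List ℕ → ℕ → ℕ
  label []       x = 0
  label (b ∷ bs) x with x <? b
  ... | yes _ = x
  ... | no  _ = label bs (x ∸ b)

  private
    block-≤ : ∀ {b} → Block b → b ≤ suc n₁
    block-≤ (inj₁ refl) = s≤s m₁≤n₁
    block-≤ (inj₂ refl) = ≤-refl

    block-last : ∀ {b} → Block b → pred b ≡ m₁ ⊎ pred b ≡ n₁
    block-last (inj₁ refl) = inj₁ refl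
    block-last (inj₂ refl) = inj₂ refl

    label-zero : ∀ {bs} → All Block bs → 0 < sum bs → label bs 0 ≡ 0
    label-zero (inj₁ refl ∷ _) _ = refl
    label-zero (inj₂ refl ∷ _) _ = refl

  label-≤ : ∀ {bs} → All Block bs → ∀ x → label bs x ≤ n₁
  label-≤ []              x = z≤n
  label-≤ {b ∷ _} (β ∷ βs) x with x <? b
  ... | yes x<b = ≤-pred (≤-trans x<b (block-≤ β))
  ... | no  _   = label-≤ βs (x ∸ b)

  private
    label-last : ∀ {bs} → All Block bs → ∀ {x} → suc x ≡ sum bs → label bs x ≡ m₁ ⊎ label bs x ≡ n₁
    label-last {b ∷ bs} (β ∷ βs) {x} sx≡ with x <? b
    ... | yes x<b = subst (λ y → y ≡ m₁ ⊎ y ≡ n₁) (cong pred (sym sx≡b)) (block-last β)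
      where
      sx≡b : suc x ≡ b
      sx≡b = ≤-antisym x<b (≤-trans (m≤m+n b (sum bs)) (≤-reflexive (sym sx≡)))
    ... | no  x≮b = label-last βs (begin
      suc (x ∸ b)        ≡⟨ sym (+-∸-assoc 1 (≮⇒≥ x≮b)) ⟩
      suc x ∸ b          ≡⟨ cong (_∸ b) sx≡ ⟩
      (b + sum bs) ∸ b   ≡⟨ m+n∸m≡n b (sum bs) ⟩
      sum bs             ∎)
      where open ≡-Reasoning

    label-suc : ∀ {bs} → All Block bs → ∀ {x} → suc x < sum bs →
                NextLabel (label bs x) (label bs (suc x))
    label-suc {b ∷ bs} (β ∷ βs) {x} sx<sum with x <? b | suc x <? b
    ... | yes _   | yes sx<b = inj₁ (refl , ≤-pred (≤-trans sx<b (block-≤ β)))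
    ... | yes x<b | no  sx≮b = inj₂ (wrap , subst (λ y → y ≡ m₁ ⊎ y ≡ n₁) (cong pred (sym sx≡b)) (block-last β))
      where
      sx≡b : suc x ≡ b
      sx≡b = ≤-antisym x<b (≮⇒≥ sx≮b)
      wrap : label bs (suc x ∸ b) ≡ 0
      wrap = trans (cong (label bs) (trans (cong (_∸ b) sx≡b) (n∸n≡0 b)))
                   (label-zero βs (+-cancelˡ-< b 0 (sum bs)
                     (subst (_< b + sum bs) (trans sx≡b (sym (+-identityʳ b))) sx<sum)))
    ... | no  x≮b | no  _ = subst (NextLabel (label bs (x ∸ b))) (cong (label bs) (sym sx∸b≡))
                              (label-suc βs (+-cancelˡ-< b _ (sum bs) (subst (_< b + sum bs) sx≡ sx<sum)))
      where
      sx∸b≡ : suc x ∸ b ≡ suc (x ∸ b)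
      sx∸b≡ = +-∸-assoc 1 (≮⇒≥ x≮b)
      sx≡ : suc x ≡ b + suc (x ∸ b)
      sx≡ = trans (cong suc (sym (m+[n∸m]≡n (≮⇒≥ x≮b)))) (sym (+-suc b (x ∸ b)))
    ... | no  x≮b | yes sx<b = contradiction (<-trans (n<1+n x) sx<b) x≮b

  label-next : ∀ {bs} → All Block bs → ∀ {N₁} → sum bs ≡ suc N₁ → ∀ {x} → x ≤ N₁ →
               NextLabel (label bs x) (label bs (CyclicOrder.next N₁ x))
  label-next βs {N₁} sum≡ {x} x≤N₁ with m≤n⇒m<n∨m≡n x≤N₁
  ... | inj₁ x<N₁ rewrite CyclicOrder.next-< N₁ x<N₁ =
    label-suc βs (subst (suc x <_) (sym sum≡) (s≤s x<N₁))
  ... | inj₂ refl rewrite CyclicOrder.next-last N₁ =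
    inj₂ (label-zero βs (subst (0 <_) (sym sum≡) z<s) , label-last βs (sym sum≡))

  blocks : ℕ → ℕ → List ℕ
  blocks p q = replicate p (suc m₁) ++ replicate q (suc n₁)

  blocks-valid : ∀ p q → All Block (blocks p q)
  blocks-valid p q = ++⁺ (replicate⁺ p (inj₁ refl)) (replicate⁺ q (inj₂ refl))

  sum-blocks : ∀ p q → sum (blocks p q) ≡ p * suc m₁ + q * suc n₁
  sum-blocks p q = begin
    sum (blocks p q)                                         ≡⟨ sum-++ (replicate p (suc m₁)) _ ⟩
    sum (replicate p (suc m₁)) + sum (replicate q (suc n₁))  ≡⟨ cong₂ _+_ (sum-replicate p) (sum-replicate q) ⟩
    p * suc m₁ + q * suc n₁                                  ∎
    where
    open ≡-Reasoning
    sum-replicate : ∀ r {b} → sum (replicate r b) ≡ r * b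
    sum-replicate zero    = refl
    sum-replicate (suc r) = cong (_ +_) (sum-replicate r)

-- The coloring of C_N □ H

clamp : (M₁ : ℕ) → ℕ → Fin (suc M₁)
clamp M₁ i = fromℕ< (s≤s (m⊓n≤n i M₁))

clamp-≤ : ∀ {M₁ i} → i ≤ M₁ → toℕ (clamp M₁ i) ≡ i
clamp-≤ {M₁} {i} i≤M₁ = trans (toℕ-fromℕ< (s≤s (m⊓n≤n i M₁))) (m≤n⇒m⊓n≡m i≤M₁)

clamp-≥ : ∀ {M₁ i} → M₁ ≤ i → toℕ (clamp M₁ i) ≡ M₁
clamp-≥ {M₁} {i} M₁≤i = trans (toℕ-fromℕ< (s≤s (m⊓n≤n i M₁))) (m≥n⇒m⊓n≡n M₁≤i)

module Construction {h : ℕ} (H : FinGraph h) (a n₁ : ℕ) (m<n : 3 + a < suc n₁) {k : ℕ}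
  (σ : EdgeColoring (Fin (suc n₁) × Fin h) k)
  (σ-star : IsStarEdgeColoring (CycProdAdj (suc n₁) H) σ)
  (σ*-star : Includes H (3 + a) (suc n₁) m<n σ) where

  m₁ : ℕ
  m₁ = 2 + a

  m : ℕ
  m = suc m₁

  m₁<n₁ : m₁ < n₁
  m₁<n₁ = ≤-pred m<n

  open BlockLabelling m₁ n₁ (<⇒≤ m₁<n₁) using (NextLabel)

  σ* : EdgeColoring (Fin m × Fin h) k
  σ* = restrictColoring m (suc n₁) m<n σ

  module Cₙ = StarColoringWalks (≡-dec _≟ᶠ_ _≟ᶠ_) (cycProd-irrefl H (s≤s (≤-trans (s≤s z≤n) m₁<n₁)))
                                (cycProd-sym H) σ-star
  module Cₘ = StarColoringWalks (≡-dec _≟ᶠ_ _≟ᶠ_) (cycProd-irrefl H (s≤s (s≤s z≤n))) (cycProd-sym H) σ*-star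

  -- The label pair {0, m - 1}: the edge leaving an m-block, which has no counterpart in C_n.
  Chord : ℕ → ℕ → Set
  Chord i j = (i ≡ 0 × j ≡ m₁) ⊎ (j ≡ 0 × i ≡ m₁)

  chord? : ∀ i j → Dec (Chord i j)
  chord? i j = (i ≟ 0 ×-dec j ≟ m₁) ⊎-dec (j ≟ 0 ×-dec i ≟ m₁)

  labelColor : ℕ → Fin h → ℕ → Fin h → Fin k
  labelColor i w j w′ with chord? i j
  ... | yes _ = σ* (clamp m₁ i , w) (clamp m₁ j , w′)
  ... | no  _ = σ (clamp n₁ i , w) (clamp n₁ j , w′)

  isWrap≡chord? : ∀ i j → isWrap m i j ≡ does (chord? i j)
  isWrap≡chord? i j = cong₂ _∨_ (cong₂ _∧_ (isYes≗does (i ≟ 0)) (isYes≗does (j ≟ m₁)))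
                                (cong₂ _∧_ (isYes≗does (j ≟ 0)) (isYes≗does (i ≟ m₁)))

  σ*-nonChord : ∀ (i j : Fin m) {w w′} → ¬ Chord (toℕ i) (toℕ j) →
                σ* (i , w) (j , w′) ≡ σ (inject≤ i (<⇒≤ m<n) , w) (inject≤ j (<⇒≤ m<n) , w′)
  σ*-nonChord i j ¬chord with isWrap m (toℕ i) (toℕ j) in wrap
  ... | false = refl
  ... | true  = contradiction (trans (sym wrap) (trans (isWrap≡chord? (toℕ i) (toℕ j)) (dec-false (chord? _ _) ¬chord))) λ ()

  σ*-chord : ∀ (i j : Fin m) {w w′} → toℕ i ≡ m₁ → toℕ j ≡ 0 →
             σ* (i , w) (j , w′) ≡ σ (fromℕ n₁ , w) (fzero , w′)
  σ*-chord i j i≡m₁ j≡0 with isWrap m (toℕ i) (toℕ j) in wrap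
  ... | true  rewrite i≡m₁ = refl
  ... | false = contradiction (trans (sym wrap) (trans (isWrap≡chord? (toℕ i) (toℕ j))
                  (dec-true (chord? _ _) (inj₂ (j≡0 , i≡m₁))))) λ ()

  σ*-chord′ : ∀ (i j : Fin m) {w w′} → toℕ i ≡ 0 → toℕ j ≡ m₁ →
              σ* (i , w) (j , w′) ≡ σ (fzero , w) (fromℕ n₁ , w′)
  σ*-chord′ i j i≡0 j≡m₁ with isWrap m (toℕ i) (toℕ j) in wrap
  ... | true  rewrite i≡0 = refl
  ... | false = contradiction (trans (sym wrap) (trans (isWrap≡chord? (toℕ i) (toℕ j))
                  (dec-true (chord? _ _) (inj₁ (i≡0 , j≡m₁))))) λ ()

  chord-sym : ∀ {i j} → Chord i j → Chord j i
  chord-sym (inj₁ c) = inj₂ c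
  chord-sym (inj₂ c) = inj₁ c

  m₁≢1 : m₁ ≢ 1
  m₁≢1 ()

  n₁≢0 : n₁ ≢ 0
  n₁≢0 refl = contradiction m₁<n₁ λ ()

  n₁≢1 : n₁ ≢ 1
  n₁≢1 refl = contradiction m₁<n₁ λ { (s≤s ()) }

  nextLabel-below : ∀ {i j} → i < m₁ → NextLabel i j → j ≡ suc i
  nextLabel-below _   (inj₁ (j≡1+i , _))     = j≡1+i
  nextLabel-below i<m₁ (inj₂ (_ , inj₁ refl)) = contradiction i<m₁ (<-irrefl refl)
  nextLabel-below i<m₁ (inj₂ (_ , inj₂ refl)) = contradiction (<-trans i<m₁ m₁<n₁) (<-irrefl refl)

  nextLabel-pred : ∀ {i j} → NextLabel i (suc j) → i ≡ j
  nextLabel-pred (inj₁ (refl , _)) = refl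

  nextLabel-nonbacktracking : ∀ {i j l} → NextLabel i j → NextLabel j l → i ≢ l
  nextLabel-nonbacktracking (inj₁ (refl , _)) (inj₁ (refl , _)) i≡l = <⇒≢ (m≤n⇒m≤1+n (n<1+n _)) i≡l
  nextLabel-nonbacktracking (inj₁ (refl , _)) (inj₂ (refl , e))  refl = [ m₁≢1 ∘ sym , n₁≢1 ∘ sym ]′ e
  nextLabel-nonbacktracking (inj₂ (refl , e)) (inj₁ (refl , _))  refl = [ m₁≢1 ∘ sym , n₁≢1 ∘ sym ]′ e
  nextLabel-nonbacktracking (inj₂ (refl , _)) (inj₂ (_ , e))     _    = [ (λ ()) , n₁≢0 ∘ sym ]′ e

  nextLabel-into-m : ∀ {i j} → NextLabel i j → j < m → i < m ⊎ (i ≡ n₁ × j ≡ 0)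
  nextLabel-into-m (inj₁ (refl , _))       j<m = inj₁ (<-trans (n<1+n _) j<m)
  nextLabel-into-m (inj₂ (_ , inj₁ refl))  _   = inj₁ ≤-refl
  nextLabel-into-m (inj₂ (j≡0 , inj₂ i≡n₁)) _  = inj₂ (i≡n₁ , j≡0)

  ¬chord-n₁-0 : ¬ Chord n₁ 0
  ¬chord-n₁-0 (inj₁ (n₁≡0 , _)) = n₁≢0 n₁≡0
  ¬chord-n₁-0 (inj₂ (_ , n₁≡m₁)) = <⇒≢ m₁<n₁ (sym n₁≡m₁)

  labelColor-n : ∀ {i j w w′} → ¬ Chord i j → labelColor i w j w′ ≡ σ (clamp n₁ i , w) (clamp n₁ j , w′)
  labelColor-n {i} {j} ¬chord with chord? i j
  ... | yes chord = contradiction chord ¬chord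
  ... | no  _     = refl

  inject≤-clamp : ∀ {i} → i < m → inject≤ (clamp m₁ i) (<⇒≤ m<n) ≡ clamp n₁ i
  inject≤-clamp i<m = toℕ-injective (begin
    toℕ (inject≤ (clamp m₁ _) (<⇒≤ m<n)) ≡⟨ toℕ-inject≤ _ _ ⟩
    toℕ (clamp m₁ _)                    ≡⟨ clamp-≤ (≤-pred i<m) ⟩
    _                                   ≡⟨ sym (clamp-≤ (≤-trans (≤-pred i<m) (<⇒≤ m₁<n₁))) ⟩
    toℕ (clamp n₁ _)                    ∎)
    where open ≡-Reasoning

  labelColor-m : ∀ {i j w w′} → i < m → j < m →
                 labelColor i w j w′ ≡ σ* (clamp m₁ i , w) (clamp m₁ j , w′)
  labelColor-m {i} {j} {w} {w′} i<m j<m with chord? i j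
  ... | yes _      = refl
  ... | no  ¬chord = sym (trans
          (σ*-nonChord (clamp m₁ i) (clamp m₁ j)
            (subst₂ (λ x y → ¬ Chord x y) (sym (clamp-≤ (≤-pred i<m))) (sym (clamp-≤ (≤-pred j<m))) ¬chord))
          (cong₂ (λ x y → σ (x , w) (y , w′)) (inject≤-clamp i<m) (inject≤-clamp j<m)))

  clamp-n₁ : clamp n₁ n₁ ≡ fromℕ n₁
  clamp-n₁ = toℕ-injective (trans (clamp-≤ ≤-refl) (sym (toℕ-fromℕ n₁)))

  labelColor-wrap : ∀ {w w′} → labelColor n₁ w 0 w′ ≡ σ* (clamp m₁ n₁ , w) (clamp m₁ 0 , w′)
  labelColor-wrap {w} {w′} = trans (labelColor-n ¬chord-n₁-0)
    (trans (cong (λ x → σ (x , w) (fzero , w′)) clamp-n₁)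
           (sym (σ*-chord (clamp m₁ n₁) (clamp m₁ 0) (clamp-≥ (<⇒≤ m₁<n₁)) refl)))

  labelColor-wrap′ : ∀ {w w′} → labelColor 0 w n₁ w′ ≡ σ* (clamp m₁ 0 , w) (clamp m₁ n₁ , w′)
  labelColor-wrap′ {w} {w′} = trans (labelColor-n (¬chord-n₁-0 ∘ chord-sym))
    (trans (cong (λ x → σ (fzero , w) (x , w′)) clamp-n₁)
           (sym (σ*-chord′ (clamp m₁ 0) (clamp m₁ n₁) refl (clamp-≥ (<⇒≤ m₁<n₁)))))

  labelColor-m-next : ∀ {i j w w′} → NextLabel i j → j < m →
                 labelColor i w j w′ ≡ σ* (clamp m₁ i , w) (clamp m₁ j , w′)
  labelColor-m-next next j<m with nextLabel-into-m next j<m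
  ... | inj₁ i<m         = labelColor-m i<m j<m
  ... | inj₂ (refl , refl) = labelColor-wrap

  labelColor-m-prev : ∀ {i j w w′} → NextLabel j i → i < m →
                  labelColor i w j w′ ≡ σ* (clamp m₁ i , w) (clamp m₁ j , w′)
  labelColor-m-prev next i<m with nextLabel-into-m next i<m
  ... | inj₁ j<m         = labelColor-m i<m j<m
  ... | inj₂ (refl , refl) = labelColor-wrap′

  nextLabel⇒cycAdj-n : ∀ {i j} → NextLabel i j → ¬ Chord i j → CycAdjℕ (suc n₁) i j
  nextLabel⇒cycAdj-n (inj₁ (refl , _))        _      = inj₁ refl
  nextLabel⇒cycAdj-n (inj₂ (refl , inj₁ refl)) ¬chord = contradiction (inj₂ (refl , refl)) ¬chord
  nextLabel⇒cycAdj-n (inj₂ (refl , inj₂ refl)) _      = inj₂ (inj₂ (inj₂ (refl , refl)))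

  nextLabel⇒cycAdj-m : ∀ {i j} → NextLabel i j → j < m →
                       CycAdjℕ m (toℕ (clamp m₁ i)) (toℕ (clamp m₁ j))
  nextLabel⇒cycAdj-m {i} {j} next j<m
    rewrite clamp-≤ (≤-pred j<m) with nextLabel-into-m next j<m
  ... | inj₂ (refl , refl) rewrite clamp-≥ (<⇒≤ m₁<n₁) = inj₂ (inj₂ (inj₂ (refl , refl)))
  ... | inj₁ i<m rewrite clamp-≤ (≤-pred i<m) with next
  ...   | inj₁ (refl , _)         = inj₁ refl
  ...   | inj₂ (refl , inj₁ refl) = inj₂ (inj₂ (inj₂ (refl , refl)))
  ...   | inj₂ (refl , inj₂ refl) = contradiction i<m (<⇒≱ (s≤s m₁<n₁))

  nextLabel-nonbacktracking-m : ∀ {i j l} → NextLabel i j → NextLabel j l → j < m → l < m →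
                                toℕ (clamp m₁ i) ≢ toℕ (clamp m₁ l)
  nextLabel-nonbacktracking-m ij jl j<m l<m rewrite clamp-≤ (≤-pred l<m) with nextLabel-into-m ij j<m
  ... | inj₁ i<m rewrite clamp-≤ (≤-pred i<m) = nextLabel-nonbacktracking ij jl
  ... | inj₂ (refl , refl) rewrite clamp-≥ (<⇒≤ m₁<n₁) | nextLabel-below (s≤s z≤n) jl = m₁≢1

  module Labelled (N₁ : ℕ) (lab : ℕ → ℕ) (lab-≤ : ∀ x → lab x ≤ n₁)
                  (lab-next : ∀ {x} → x ≤ N₁ → NextLabel (lab x) (lab (CyclicOrder.next N₁ x))) where
    open CyclicOrder N₁

    Vertex : Set
    Vertex = Fin (suc N₁) × Fin h

    _~_ : Vertex → Vertex → Set
    _~_ = CycProdAdj (suc N₁) H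

    pos : Vertex → ℕ
    pos u = toℕ (proj₁ u)

    pos-≤ : ∀ u → pos u ≤ N₁
    pos-≤ u = ≤-pred (toℕ<n (proj₁ u))

    fib : Vertex → Fin h
    fib = proj₂

    L : Vertex → ℕ
    L u = lab (pos u)

    τ : EdgeColoring Vertex k
    τ u v = labelColor (L u) (fib u) (L v) (fib v)

    data Kind (u v : Vertex) : Set where
      inFiber  : proj₁ u ≡ proj₁ v → Adj H (fib u) (fib v) → Kind u v
      forward  : pos v ≡ next (pos u) → fib u ≡ fib v → Kind u v
      backward : pos u ≡ next (pos v) → fib u ≡ fib v → Kind u v

    classify : ∀ {u v} → u ~ v → Kind u v
    classify {u} {v} (inj₁ (cyc , w≡w′)) with cycAdj⇒next (pos-≤ u) (pos-≤ v) cyc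
    ... | inj₁ v-next = forward v-next w≡w′
    ... | inj₂ u-next = backward u-next w≡w′
    classify (inj₂ (i≡j , a)) = inFiber i≡j a

    module WalkKinds (W : AlternatingWalk _~_ τ) where
      open AlternatingWalk W public

      e₀ : Kind w₀ w₁
      e₀ = classify a₀₁
      e₁ : Kind w₁ w₂
      e₁ = classify a₁₂
      e₂ : Kind w₂ w₃
      e₂ = classify a₂₃
      e₃ : Kind w₃ w₄
      e₃ = classify a₃₄

    module ClosedWalkKinds (W : AlternatingClosedWalk _~_ τ) where
      open AlternatingClosedWalk W public

      e₀ : Kind w₀ w₁
      e₀ = classify a₀₁
      e₁ : Kind w₁ w₂
      e₁ = classify a₁₂
      e₂ : Kind w₂ w₃
      e₂ = classify a₂₃
      e₃ : Kind w₃ w₀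
      e₃ = classify a₃₀

    reverseKind : ∀ {u v} → Kind u v → Kind v u
    reverseKind (inFiber i≡j a)   = inFiber (sym i≡j) (Graph.sym H a)
    reverseKind (forward p w≡w′)  = backward p (sym w≡w′)
    reverseKind (backward p w≡w′) = forward p (sym w≡w′)

    next-label : ∀ {u v} → pos v ≡ next (pos u) → NextLabel (L u) (L v)
    next-label {u} {v} v-next = subst (NextLabel (L u) ∘ lab) (sym v-next) (lab-next (pos-≤ u))

    fiber-label : ∀ u v → proj₁ u ≡ proj₁ v → L u ≡ L v
    fiber-label _ _ i≡j = cong (lab ∘ toℕ) i≡j

    front : ∀ {u v} → Kind u v → Vertex
    front {u} (inFiber _ _)  = u
    front {v = v} (forward _ _) = v
    front {u} (backward _ _) = u

    -- front e is the endpoint of e further along the cycle; e maps into C_m □ H under ψ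
    -- as soon as its label is below m.
    ψ-Fits : ∀ {u v} → Kind u v → Set
    ψ-Fits e = L (front e) < m

    ψ-fits-reverse : ∀ {u v} (e : Kind u v) → ψ-Fits (reverseKind e) → ψ-Fits e
    ψ-fits-reverse {u} {v} (inFiber i≡j _) v<m = subst (_< m) (fiber-label v u (sym i≡j)) v<m
    ψ-fits-reverse (forward _ _)  v<m = v<m
    ψ-fits-reverse (backward _ _) u<m = u<m

    ψ-fits-both : ∀ {u v} (e : Kind u v) → L u < m → L v < m → ψ-Fits e
    ψ-fits-both (inFiber _ _)  u<m _   = u<m
    ψ-fits-both (forward _ _)  _   v<m = v<m
    ψ-fits-both (backward _ _) u<m _   = u<m

    φ : Vertex → Fin (suc n₁) × Fin h
    φ u = clamp n₁ (L u) , fib u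

    -- Labels ≥ m occur only inside n-blocks; clamping them to m - 1 sends the edge n - 1 → 0
    -- closing an n-block onto the wrap-around edge of C_m, which σ* colors the same way.
    ψ : Vertex → Fin m × Fin h
    ψ u = clamp m₁ (L u) , fib u

    φ-label : ∀ u → toℕ (clamp n₁ (L u)) ≡ L u
    φ-label u = clamp-≤ (lab-≤ (pos u))

    φ-edge : ∀ {u v} → Kind u v → ¬ Chord (L u) (L v) → EdgeImage (CycProdAdj (suc n₁) H) σ τ φ u v
    φ-edge {u} {v} e ¬chord = edgeImage (adj e) (sym (labelColor-n ¬chord))
      where
      adj : Kind u v → CycProdAdj (suc n₁) H (φ u) (φ v)
      adj (inFiber i≡j a) = inj₂ (cong (clamp n₁) (fiber-label u v i≡j) , a)
      adj (forward v-next w≡w′) = inj₁ (subst₂ (CycAdjℕ (suc n₁)) (sym (φ-label u)) (sym (φ-label v))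
        (nextLabel⇒cycAdj-n (next-label {u} {v} v-next) ¬chord) , w≡w′)
      adj (backward u-next w≡w′) = inj₁ (subst₂ (CycAdjℕ (suc n₁)) (sym (φ-label u)) (sym (φ-label v))
        (cycAdj-sym (nextLabel⇒cycAdj-n (next-label {v} {u} u-next) (¬chord ∘ chord-sym))) , w≡w′)

    ψ-edge : ∀ {u v} (e : Kind u v) → ψ-Fits e → EdgeImage (CycProdAdj m H) σ* τ ψ u v
    ψ-edge {u} {v} (inFiber i≡j a) u<m = edgeImage
      (inj₂ (cong (clamp m₁) (fiber-label u v i≡j) , a))
      (sym (labelColor-m u<m (subst (_< m) (fiber-label u v i≡j) u<m)))
    ψ-edge {u} {v} (forward v-next w≡w′) v<m = edgeImage
      (inj₁ (nextLabel⇒cycAdj-m (next-label {u} {v} v-next) v<m , w≡w′))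
      (sym (labelColor-m-next (next-label {u} {v} v-next) v<m))
    ψ-edge {u} {v} (backward u-next w≡w′) u<m = edgeImage
      (inj₁ (cycAdj-sym (nextLabel⇒cycAdj-m (next-label {v} {u} u-next) u<m) , w≡w′))
      (sym (labelColor-m-prev (next-label {v} {u} u-next) u<m))

    same-vertex : ∀ {u z} → pos u ≡ pos z → fib u ≡ fib z → u ≡ z
    same-vertex {_ , w} {_ , .w} i≡j refl = cong (_, w) (toℕ-injective i≡j)

    fiber-≢ : ∀ {w w′} → Adj H w w′ → w ≢ w′
    fiber-≢ a refl = Graph.irrefl H a

    nonbacktracking-steps : ∀ {u v z} (e : Kind u v) (e′ : Kind v z) → u ≢ z →
      fib u ≢ fib z ⊎
      (NextLabel (L u) (L v) × NextLabel (L v) (L z) × front e ≡ v × front e′ ≡ z) ⊎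
      (NextLabel (L z) (L v) × NextLabel (L v) (L u) × front e ≡ u × front e′ ≡ v)
    nonbacktracking-steps {u} {v} {z} (forward p _) (forward p′ _) _ =
      inj₂ (inj₁ (next-label {u} {v} p , next-label {v} {z} p′ , refl , refl))
    nonbacktracking-steps {u} {v} {z} (backward p _) (backward p′ _) _ =
      inj₂ (inj₂ (next-label {z} {v} p′ , next-label {v} {u} p , refl , refl))
    nonbacktracking-steps (inFiber i≡j _) (inFiber j≡l _) u≢z =
      inj₁ (u≢z ∘ same-vertex (cong toℕ (trans i≡j j≡l)))
    nonbacktracking-steps (inFiber _ a) (forward _ w≡w′)  _ = inj₁ (λ e → fiber-≢ a (trans e (sym w≡w′)))
    nonbacktracking-steps (inFiber _ a) (backward _ w≡w′) _ = inj₁ (λ e → fiber-≢ a (trans e (sym w≡w′)))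
    nonbacktracking-steps (forward _ w≡w′)  (inFiber _ a) _ = inj₁ (λ e → fiber-≢ a (trans (sym w≡w′) e))
    nonbacktracking-steps (backward _ w≡w′) (inFiber _ a) _ = inj₁ (λ e → fiber-≢ a (trans (sym w≡w′) e))
    nonbacktracking-steps (forward p _) (backward p′ _) u≢z =
      inj₁ (u≢z ∘ same-vertex (next-injective (trans (sym p) p′)))
    nonbacktracking-steps (backward p _) (forward p′ _) u≢z = inj₁ (u≢z ∘ same-vertex (trans p (sym p′)))

    φ-labels : ∀ {u z} → φ u ≡ φ z → L u ≡ L z
    φ-labels {u} {z} φ≡ = trans (sym (φ-label u)) (trans (cong (toℕ ∘ proj₁) φ≡) (φ-label z))

    φ-nonbacktracking : ∀ {u v z} → Kind u v → Kind v z → u ≢ z → φ u ≢ φ z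
    φ-nonbacktracking e e′ u≢z with nonbacktracking-steps e e′ u≢z
    ... | inj₁ fib≢                 = fib≢ ∘ cong proj₂
    ... | inj₂ (inj₁ (uv , vz , _)) = nextLabel-nonbacktracking uv vz ∘ φ-labels
    ... | inj₂ (inj₂ (zv , vu , _)) = nextLabel-nonbacktracking zv vu ∘ sym ∘ φ-labels

    ψ-nonbacktracking : ∀ {u v z} (e : Kind u v) → ψ-Fits e → (e′ : Kind v z) → ψ-Fits e′ →
                        u ≢ z → ψ u ≢ ψ z
    ψ-nonbacktracking e g e′ g′ u≢z with nonbacktracking-steps e e′ u≢z
    ... | inj₁ fib≢ = fib≢ ∘ cong proj₂
    ... | inj₂ (inj₁ (uv , vz , fe≡v , fe′≡z)) =
      nextLabel-nonbacktracking-m uv vz (subst (λ x → L x < m) fe≡v g) (subst (λ x → L x < m) fe′≡z g′)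
      ∘ cong (toℕ ∘ proj₁)
    ... | inj₂ (inj₂ (zv , vu , fe≡u , fe′≡v)) =
      nextLabel-nonbacktracking-m zv vu (subst (λ x → L x < m) fe′≡v g′) (subst (λ x → L x < m) fe≡u g)
      ∘ sym ∘ cong (toℕ ∘ proj₁)

    φ-walk : (W : AlternatingWalk _~_ τ) → let open WalkKinds W in
             ¬ Chord (L w₀) (L w₁) → ¬ Chord (L w₁) (L w₂) → ¬ Chord (L w₂) (L w₃) → ¬ Chord (L w₃) (L w₄) → ⊥
    φ-walk W ¬c₀ ¬c₁ ¬c₂ ¬c₃ = Cₙ.no-alternatingWalk
      (mapWalk φ W (φ-edge e₀ ¬c₀) (φ-edge e₁ ¬c₁) (φ-edge e₂ ¬c₂) (φ-edge e₃ ¬c₃)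
        (φ-nonbacktracking e₀ e₁ w₀≢w₂) (φ-nonbacktracking e₁ e₂ w₁≢w₃) (φ-nonbacktracking e₂ e₃ w₂≢w₄))
      where
      open WalkKinds W

    ψ-walk : (W : AlternatingWalk _~_ τ) → let open WalkKinds W in
             ψ-Fits e₀ → ψ-Fits e₁ → ψ-Fits e₂ → ψ-Fits e₃ → ⊥
    ψ-walk W g₀ g₁ g₂ g₃ = Cₘ.no-alternatingWalk
      (mapWalk ψ W (ψ-edge e₀ g₀) (ψ-edge e₁ g₁) (ψ-edge e₂ g₂) (ψ-edge e₃ g₃)
        (ψ-nonbacktracking e₀ g₀ e₁ g₁ w₀≢w₂) (ψ-nonbacktracking e₁ g₁ e₂ g₂ w₁≢w₃)
        (ψ-nonbacktracking e₂ g₂ e₃ g₃ w₂≢w₄))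
      where
      open WalkKinds W

    φ-closedWalk : (W : AlternatingClosedWalk _~_ τ) → let open ClosedWalkKinds W in
                   ¬ Chord (L w₀) (L w₁) → ¬ Chord (L w₁) (L w₂) → ¬ Chord (L w₂) (L w₃) → ¬ Chord (L w₃) (L w₀) → ⊥
    φ-closedWalk W ¬c₀ ¬c₁ ¬c₂ ¬c₃ = Cₙ.no-alternatingClosedWalk
      (mapClosedWalk φ W (φ-edge e₀ ¬c₀) (φ-edge e₁ ¬c₁) (φ-edge e₂ ¬c₂) (φ-edge e₃ ¬c₃)
        (φ-nonbacktracking e₀ e₁ w₀≢w₂) (φ-nonbacktracking e₁ e₂ w₁≢w₃))
      where
      open ClosedWalkKinds W

    ψ-closedWalk : (W : AlternatingClosedWalk _~_ τ) → let open ClosedWalkKinds W in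
                   ψ-Fits e₀ → ψ-Fits e₁ → ψ-Fits e₂ → ψ-Fits e₃ → ⊥
    ψ-closedWalk W g₀ g₁ g₂ g₃ = Cₘ.no-alternatingClosedWalk
      (mapClosedWalk ψ W (ψ-edge e₀ g₀) (ψ-edge e₁ g₁) (ψ-edge e₂ g₂) (ψ-edge e₃ g₃)
        (ψ-nonbacktracking e₀ g₀ e₁ g₁ w₀≢w₂) (ψ-nonbacktracking e₁ g₁ e₂ g₂ w₁≢w₃))
      where
      open ClosedWalkKinds W

    chord-labels : ∀ {i j} → Chord i j → i < m × j < m
    chord-labels (inj₁ (refl , refl)) = s≤s z≤n , ≤-refl
    chord-labels (inj₂ (refl , refl)) = ≤-refl , s≤s z≤n

    chord-fits : ∀ {u v} (e : Kind u v) → Chord (L u) (L v) → ψ-Fits e × ψ-Fits (reverseKind e)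
    chord-fits e chord with chord-labels chord
    ... | u<m , v<m = ψ-fits-both e u<m v<m , ψ-fits-both (reverseKind e) v<m u<m

    τ-symmetric : Symmetric _~_ τ
    τ-symmetric {u} {v} a = by-chord (chord? (L u) (L v))
      where
      e : Kind u v
      e = classify a
      by-chord : Dec (Chord (L u) (L v)) → τ u v ≡ τ v u
      by-chord (no ¬chord) = image-symmetric φ (IsStarEdgeColoring.symmetric σ-star)
        (φ-edge e ¬chord) (φ-edge (reverseKind e) (¬chord ∘ chord-sym))
      by-chord (yes chord) = image-symmetric ψ (IsStarEdgeColoring.symmetric σ*-star)
        (ψ-edge e (proj₁ (chord-fits e chord))) (ψ-edge (reverseKind e) (proj₂ (chord-fits e chord)))

    chord-forward : ∀ {u v} → Kind u v → L u ≡ m₁ → L v ≡ 0 → pos v ≡ next (pos u) × fib u ≡ fib v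
    chord-forward {u} {v} (inFiber i≡j _) Lu≡m₁ Lv≡0 =
      contradiction (trans (sym Lu≡m₁) (trans (fiber-label u v i≡j) Lv≡0)) λ ()
    chord-forward (forward v-next w≡w′) _ _ = v-next , w≡w′
    chord-forward {u} {v} (backward u-next _) Lu≡m₁ Lv≡0 =
      contradiction (nextLabel-below (s≤s z≤n) (subst₂ NextLabel Lv≡0 Lu≡m₁ (next-label {v} {u} u-next))) λ ()

    -- Positions P 0 … P 8 around a chord edge P 4 → P 5; walks of length 4 through the chord
    -- stay among them, and P 2 … P 7 carry labels below m.
    module Window (x₀ : ℕ) (x₀≤N₁ : x₀ ≤ N₁) (lab-x₀ : lab x₀ ≡ m₁) (lab-next-x₀ : lab (next x₀) ≡ 0) where

      P : ℕ → ℕ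
      P zero    = prev (prev (prev (prev x₀)))
      P (suc i) = next (P i)

      P-≤ : ∀ i → P i ≤ N₁
      P-≤ zero    = prev-≤ (prev-≤ (prev-≤ (prev-≤ x₀≤N₁)))
      P-≤ (suc i) = next-≤ (P-≤ i)

      P-4 : P 4 ≡ x₀
      P-4 rewrite next-prev (prev-≤ (prev-≤ (prev-≤ x₀≤N₁))) | next-prev (prev-≤ (prev-≤ x₀≤N₁))
                | next-prev (prev-≤ x₀≤N₁) | next-prev x₀≤N₁ = refl

      step : ∀ i → NextLabel (lab (P i)) (lab (P (suc i)))
      step i = lab-next (P-≤ i)

      label-4 : lab (P 4) ≡ m₁
      label-4 = trans (cong lab P-4) lab-x₀

      label-5 : lab (P 5) ≡ 0
      label-5 = trans (cong (lab ∘ next) P-4) lab-next-x₀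

      label-6 : lab (P 6) ≡ 1
      label-6 = nextLabel-below (s≤s z≤n) (subst (λ i → NextLabel i (lab (P 6))) label-5 (step 5))

      label-7 : lab (P 7) ≡ 2
      label-7 = nextLabel-below (s≤s (s≤s z≤n)) (subst (λ i → NextLabel i (lab (P 7))) label-6 (step 6))

      label-3 : lab (P 3) ≡ suc a
      label-3 = nextLabel-pred (subst (NextLabel (lab (P 3))) label-4 (step 3))

      label-2 : lab (P 2) ≡ a
      label-2 = nextLabel-pred (subst (NextLabel (lab (P 2))) label-3 (step 2))

      window : ∀ {t} → 2 ≤ t → t ≤ 7 → lab (P t) < m
      window {2} _ _ rewrite label-2 = m≤n⇒m≤1+n (m≤n⇒m≤1+n (n<1+n a))
      window {3} _ _ rewrite label-3 = m≤n⇒m≤1+n (n<1+n (suc a))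
      window {4} _ _ rewrite label-4 = ≤-refl
      window {5} _ _ rewrite label-5 = s≤s z≤n
      window {6} _ _ rewrite label-6 = s≤s (s≤s z≤n)
      window {7} _ _ rewrite label-7 = s≤s (s≤s (s≤s z≤n))
      window {1} (s≤s ()) _
      window {suc (suc (suc (suc (suc (suc (suc (suc _)))))))} _ (s≤s (s≤s (s≤s (s≤s (s≤s (s≤s (s≤s ())))))))

      window-8 : lab (P 8) < m → ∀ {t} → 2 ≤ t → t ≤ 8 → lab (P t) < m
      window-8 P8<m 2≤t t≤8 with m≤n⇒m<n∨m≡n t≤8
      ... | inj₁ t<8  = window 2≤t (≤-pred t<8)
      ... | inj₂ refl = P8<m

      a≡0-or-label₈<m : a ≡ 0 ⊎ lab (P 8) < m
      a≡0-or-label₈<m with a ≟ 0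
      ... | yes a≡0 = inj₁ a≡0
      ... | no  a≢0 = inj₂ (subst (_< m) (sym label-8) (+-monoʳ-< 3 (n≢0⇒n>0 a≢0)))
        where
        label-8 : lab (P 8) ≡ 3
        label-8 = nextLabel-below (s≤s (s≤s (n≢0⇒n>0 a≢0)))
                    (subst (λ i → NextLabel i (lab (P 8))) label-7 (step 7))

      -- Reaching the upper bound hi needs forward moves only, which keep the fiber coordinate w.
      record Located (w : Fin h) (u : Vertex) (lo hi : ℕ) : Set where
        field
          index    : ℕ
          at       : pos u ≡ P index
          lo≤index : lo ≤ index
          index≤hi : index ≤ hi
          at-hi    : index ≡ hi → fib u ≡ w
      open Located public

      start : ∀ {u i} → pos u ≡ P i → Located (fib u) u i i
      start at = record { index = _ ; at = at ; lo≤index = ≤-refl ; index≤hi = ≤-refl ; at-hi = λ _ → refl }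

      advance : ∀ {w u v lo hi} {_ : T (2 ≤ᵇ lo)} → Located w u lo hi → Kind u v → Located w v (pred lo) (suc hi)
      advance {v = v} {lo = lo} {_} {2≤lo} r e = go e
        where
        lo≥2 : 2 ≤ lo
        lo≥2 = ≤ᵇ⇒≤ 2 lo 2≤lo
        go : Kind _ _ → Located _ _ (pred lo) (suc _)
        go (inFiber i≡j _) = record
          { index = index r ; at = trans (cong toℕ (sym i≡j)) (at r)
          ; lo≤index = ≤-trans pred[n]≤n (lo≤index r) ; index≤hi = m≤n⇒m≤1+n (index≤hi r)
          ; at-hi = λ i≡1+hi → contradiction (index≤hi r) (<⇒≱ (≤-reflexive (sym i≡1+hi))) }
        go (forward v-next w≡w′) = record
          { index = suc (index r) ; at = trans v-next (cong next (at r))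
          ; lo≤index = ≤-trans pred[n]≤n (m≤n⇒m≤1+n (lo≤index r)) ; index≤hi = s≤s (index≤hi r)
          ; at-hi = λ i≡hi → trans (sym w≡w′) (at-hi r (suc-injective i≡hi)) }
        go (backward u-next w≡w′) with index r | at r | lo≤index r | index≤hi r
        ... | suc i | u-at | lo≤1+i | 1+i≤hi = record
          { index = i ; at = next-injective (trans (sym u-next) u-at)
          ; lo≤index = pred-mono-≤ lo≤1+i ; index≤hi = m≤n⇒m≤1+n (≤-trans (n≤1+n i) 1+i≤hi)
          ; at-hi = λ i≡1+hi → contradiction (≤-trans (n≤1+n i) 1+i≤hi) (<⇒≱ (≤-reflexive (sym i≡1+hi))) }
        ... | zero | _ | lo≤0 | _ = contradiction (≤-trans lo≥2 lo≤0) λ ()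

      fits-at : ∀ {w u v lo hi} (r : Located w u lo hi) → lab (P (index r)) < m → lab (P (suc (index r))) < m →
                (e : Kind u v) → ψ-Fits e
      fits-at r here<m _      (inFiber _ _)       = subst (λ x → lab x < m) (sym (at r)) here<m
      fits-at r _      next<m (forward v-next _)  = subst (λ x → lab x < m) (sym (trans v-next (cong next (at r)))) next<m
      fits-at r here<m _      (backward _ _)      = subst (λ x → lab x < m) (sym (at r)) here<m

      -- lo and hi are literals at every use, so the side conditions are discharged by evaluation.
      fits-within : ∀ {w u v lo hi} {_ : T (2 ≤ᵇ lo)} {_ : T (hi ≤ᵇ 6)} → Located w u lo hi → (e : Kind u v) → ψ-Fits e
      fits-within {lo = lo} {hi} {2≤lo} {hi≤6} r =
        fits-at r (window 2≤i (≤-trans (index≤hi r) (≤-trans hi≤6′ (n≤1+n 6))))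
                  (window (m≤n⇒m≤1+n 2≤i) (s≤s (≤-trans (index≤hi r) hi≤6′)))
        where
        hi≤6′ : hi ≤ 6
        hi≤6′ = ≤ᵇ⇒≤ hi 6 hi≤6
        2≤i : 2 ≤ index r
        2≤i = ≤-trans (≤ᵇ⇒≤ 2 lo 2≤lo) (lo≤index r)

    module AtChord {u v} (e : Kind u v) (Lu≡m₁ : L u ≡ m₁) (Lv≡0 : L v ≡ 0) where
      v-next : pos v ≡ next (pos u)
      v-next = proj₁ (chord-forward e Lu≡m₁ Lv≡0)

      open Window (pos u) (pos-≤ u) Lu≡m₁ (trans (cong lab (sym v-next)) Lv≡0) public

      at₄ : Located (fib u) u 4 4
      at₄ = start (sym P-4)

      at₅ : Located (fib v) v 5 5
      at₅ = start (trans v-next (cong next (sym P-4)))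

      chord-fits-forward : ψ-Fits e
      chord-fits-forward = proj₁ (chord-fits e (inj₂ (Lv≡0 , Lu≡m₁)))

    walk-chord₀ : (W : AlternatingWalk _~_ τ) → let open WalkKinds W in L w₀ ≡ m₁ → L w₁ ≡ 0 → ⊥
    walk-chord₀ W l₀ l₁ = go a≡0-or-label₈<m
      where
      open WalkKinds W
      open AtChord e₀ l₀ l₁
      r₃ : Located (fib w₁) w₃ 3 7
      r₃ = advance (advance at₅ e₁) e₂
      fits₁ : ψ-Fits e₁
      fits₁ = fits-within at₅ e₁
      fits₂ : ψ-Fits e₂
      fits₂ = fits-within (advance at₅ e₁) e₂
      2≤i₃ : 2 ≤ index r₃
      2≤i₃ = ≤-trans (m≤n⇒m≤1+n ≤-refl) (lo≤index r₃)
      go : a ≡ 0 ⊎ lab (P 8) < m → ⊥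
      go (inj₂ P8<m) = ψ-walk W chord-fits-forward fits₁ fits₂
        (fits-at r₃ (window 2≤i₃ (index≤hi r₃)) (window-8 P8<m (m≤n⇒m≤1+n 2≤i₃) (s≤s (index≤hi r₃))) e₃)
      -- m = 3: if w₃ sits at P 7 (label 2 = m - 1), then w₀ and w₃ have the same image under ψ.
      go (inj₁ a≡0) with index r₃ ≟ 7
      ... | no i₃≢7 = ψ-walk W chord-fits-forward fits₁ fits₂
        (fits-at r₃ (window 2≤i₃ (index≤hi r₃)) (window (m≤n⇒m≤1+n 2≤i₃) (≤∧≢⇒< (index≤hi r₃) i₃≢7)) e₃)
      ... | yes i₃≡7 = Cₘ.triangle-colors (adjacent ψe₀) (adjacent ψe₁) (adjacent ψe₂) ψw₀≡ψw₃
                         (trans (color ψe₀) (trans c₀₁≡c₂₃ (sym (color ψe₂))))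
        where
        ψe₀ : EdgeImage (CycProdAdj m H) σ* τ ψ w₀ w₁
        ψe₀ = ψ-edge e₀ chord-fits-forward
        ψe₁ : EdgeImage (CycProdAdj m H) σ* τ ψ w₁ w₂
        ψe₁ = ψ-edge e₁ fits₁
        ψe₂ : EdgeImage (CycProdAdj m H) σ* τ ψ w₂ w₃
        ψe₂ = ψ-edge e₂ fits₂
        L₀≡L₃ : L w₀ ≡ L w₃
        L₀≡L₃ = trans l₀ (trans (cong (2 +_) a≡0) (sym (trans (cong lab (trans (at r₃) (cong P i₃≡7))) label-7)))
        ψw₀≡ψw₃ : ψ w₀ ≡ ψ w₃
        ψw₀≡ψw₃ = cong₂ _,_ (cong (clamp m₁) L₀≡L₃) (trans (proj₂ (chord-forward e₀ l₀ l₁)) (sym (at-hi r₃ i₃≡7)))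

    walk-chord₁ : (W : AlternatingWalk _~_ τ) → let open WalkKinds W in L w₁ ≡ m₁ → L w₂ ≡ 0 → ⊥
    walk-chord₁ W l₁ l₂ = ψ-walk W (ψ-fits-reverse e₀ (fits-within at₄ (reverseKind e₀))) chord-fits-forward
                                   (fits-within at₅ e₂) (fits-within (advance at₅ e₂) e₃)
      where
      open WalkKinds W
      open AtChord e₁ l₁ l₂

    walk-chord₂ : (W : AlternatingWalk _~_ τ) → let open WalkKinds W in L w₂ ≡ m₁ → L w₃ ≡ 0 → ⊥
    walk-chord₂ W l₂ l₃ = ψ-walk W (ψ-fits-reverse e₀ (fits-within (advance at₄ (reverseKind e₁)) (reverseKind e₀)))
                                   (ψ-fits-reverse e₁ (fits-within at₄ (reverseKind e₁))) chord-fits-forward (fits-within at₅ e₃)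
      where
      open WalkKinds W
      open AtChord e₂ l₂ l₃

    walk-chord₃ : (W : AlternatingWalk _~_ τ) → let open WalkKinds W in L w₃ ≡ m₁ → L w₄ ≡ 0 → ⊥
    walk-chord₃ W l₃ l₄ = ψ-walk W (ψ-fits-reverse e₀ (fits-within r₁ (reverseKind e₀)))
                                   (ψ-fits-reverse e₁ (fits-within r₂ (reverseKind e₁)))
                                   (ψ-fits-reverse e₂ (fits-within at₄ (reverseKind e₂))) chord-fits-forward
      where
      open WalkKinds W
      open AtChord e₃ l₃ l₄
      r₂ : Located (fib w₃) w₂ 3 5
      r₂ = advance at₄ (reverseKind e₂)
      r₁ : Located (fib w₃) w₁ 2 6
      r₁ = advance r₂ (reverseKind e₁)

    closedWalk-chord : (W : AlternatingClosedWalk _~_ τ) → let open ClosedWalkKinds W in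
                       L w₀ ≡ m₁ → L w₁ ≡ 0 → ⊥
    closedWalk-chord W l₀ l₁ = ψ-closedWalk W chord-fits-forward (fits-within at₅ e₁) (fits-within (advance at₅ e₁) e₂)
                                            (ψ-fits-reverse e₃ (fits-within at₄ (reverseKind e₃)))
      where
      open ClosedWalkKinds W
      open AtChord e₀ l₀ l₁

    proper-at-chord : ∀ {u v z} (e₁ : Kind u v) (e₂ : Kind u z) → Chord (L u) (L v) → v ≢ z → τ u v ≢ τ u z
    proper-at-chord {u} {v} e₁ e₂ chord v≢z =
      image-proper ψ (IsStarEdgeColoring.proper σ*-star) (ψ-edge e₁ (proj₁ fits₁)) (ψ-edge e₂ (fits₂ chord))
        (ψ-nonbacktracking (reverseKind e₁) (proj₂ fits₁) e₂ (fits₂ chord) v≢z)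
      where
      fits₁ : ψ-Fits e₁ × ψ-Fits (reverseKind e₁)
      fits₁ = chord-fits e₁ chord
      fits₂ : Chord (L u) (L v) → ψ-Fits e₂
      fits₂ (inj₂ (Lv≡0 , Lu≡m₁)) = fits-within at₄ e₂ where open AtChord e₁ Lu≡m₁ Lv≡0
      fits₂ (inj₁ (Lu≡0 , Lv≡m₁)) = fits-within at₅ e₂ where open AtChord (reverseKind e₁) Lv≡m₁ Lu≡0

    τ-proper : Proper _~_ τ
    τ-proper {u} {v} {z} a₁ a₂ v≢z = by-chords (chord? (L u) (L v)) (chord? (L u) (L z))
      where
      e₁ : Kind u v
      e₁ = classify a₁
      e₂ : Kind u z
      e₂ = classify a₂
      by-chords : Dec (Chord (L u) (L v)) → Dec (Chord (L u) (L z)) → τ u v ≢ τ u z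
      by-chords (yes chord) _           = proper-at-chord e₁ e₂ chord v≢z
      by-chords (no _)      (yes chord) = proper-at-chord e₂ e₁ chord (v≢z ∘ sym) ∘ sym
      by-chords (no ¬c₁)    (no ¬c₂)    = image-proper φ (IsStarEdgeColoring.proper σ-star)
        (φ-edge e₁ ¬c₁) (φ-edge e₂ ¬c₂) (φ-nonbacktracking (reverseKind e₁) e₂ v≢z)

    τ-no-alternatingWalk : ¬ AlternatingWalk _~_ τ
    τ-no-alternatingWalk W = go
      where
      open AlternatingWalk W
      W⁻ : AlternatingWalk _~_ τ
      W⁻ = reverse (cycProd-sym H) τ-symmetric W
      go : ⊥
      go with chord? (L w₀) (L w₁)
      ... | yes (inj₂ (l₁ , l₀)) = walk-chord₀ W l₀ l₁
      ... | yes (inj₁ (l₀ , l₁)) = walk-chord₃ W⁻ l₁ l₀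
      ... | no ¬c₀ with chord? (L w₁) (L w₂)
      ...   | yes (inj₂ (l₂ , l₁)) = walk-chord₁ W l₁ l₂
      ...   | yes (inj₁ (l₁ , l₂)) = walk-chord₂ W⁻ l₂ l₁
      ...   | no ¬c₁ with chord? (L w₂) (L w₃)
      ...     | yes (inj₂ (l₃ , l₂)) = walk-chord₂ W l₂ l₃
      ...     | yes (inj₁ (l₂ , l₃)) = walk-chord₁ W⁻ l₃ l₂
      ...     | no ¬c₂ with chord? (L w₃) (L w₄)
      ...       | yes (inj₂ (l₄ , l₃)) = walk-chord₃ W l₃ l₄
      ...       | yes (inj₁ (l₃ , l₄)) = walk-chord₀ W⁻ l₄ l₃
      ...       | no ¬c₃ = φ-walk W ¬c₀ ¬c₁ ¬c₂ ¬c₃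

    closedWalk-chord-either : (W : AlternatingClosedWalk _~_ τ) → let open ClosedWalkKinds W in
                              Chord (L w₀) (L w₁) → ⊥
    closedWalk-chord-either W (inj₂ (l₁ , l₀)) = closedWalk-chord W l₀ l₁
    closedWalk-chord-either W (inj₁ (l₀ , l₁)) =
      closedWalk-chord (reverseClosed (cycProd-sym H) τ-symmetric (rotate W)) l₁ l₀

    τ-no-alternatingClosedWalk : ¬ AlternatingClosedWalk _~_ τ
    τ-no-alternatingClosedWalk W = go
      where
      open AlternatingClosedWalk W
      go : ⊥
      go with chord? (L w₀) (L w₁)
      ... | yes chord = closedWalk-chord-either W chord
      ... | no ¬c₀ with chord? (L w₁) (L w₂)
      ...   | yes chord = closedWalk-chord-either (rotate W) chord
      ...   | no ¬c₁ with chord? (L w₂) (L w₃)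
      ...     | yes chord = closedWalk-chord-either (rotate (rotate W)) chord
      ...     | no ¬c₂ with chord? (L w₃) (L w₀)
      ...       | yes chord = closedWalk-chord-either (rotate (rotate (rotate W))) chord
      ...       | no ¬c₃ = φ-closedWalk W ¬c₀ ¬c₁ ¬c₂ ¬c₃

    τ-isStar : IsStarEdgeColoring _~_ τ
    τ-isStar = star-if-no-alternating (cycProd-sym H) τ-symmetric τ-proper τ-no-alternatingWalk τ-no-alternatingClosedWalk

positive-combination : ∀ {m₁ n₁} p q → ¬ (p ≡ 0 × q ≡ 0) → ∃[ N₁ ] p * suc m₁ + q * suc n₁ ≡ suc N₁
positive-combination (suc p) q       _        = _ , refl
positive-combination zero    (suc q) _        = _ , refl
positive-combination zero    zero    p,q≢0,0 = contradiction (refl , refl) p,q≢0,0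

lemma5 : (h : ℕ) (H : FinGraph h) (m n k : ℕ) → 3 ≤ m → (m<n : m < n) → 1 ≤ k →
         (σ : EdgeColoring (Fin n × Fin h) k) →
         IsStarEdgeColoring (CycProdAdj n H) σ →
         Includes H m n m<n σ →
         (p q : ℕ) → ¬ (p ≡ 0 × q ≡ 0) →
         StarColorableCycProd (p * m + q * n) H k
lemma5 h H (suc (suc (suc a))) (suc n₁) k (s≤s (s≤s (s≤s _))) m<n _ σ σ-star σ*-star p q p,q≢0,0 =
  subst (λ N → StarColorableCycProd N H k) (sym length≡) (τ , τ-isStar)
  where
  N₁ : ℕ
  N₁ = proj₁ (positive-combination p q p,q≢0,0)
  length≡ : p * suc (suc (suc a)) + q * suc n₁ ≡ suc N₁
  length≡ = proj₂ (positive-combination p q p,q≢0,0)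
  open BlockLabelling (2 + a) n₁ (<⇒≤ (≤-pred m<n))
  open Construction H a n₁ m<n σ σ-star σ*-star
  open Labelled N₁ (label (blocks p q)) (label-≤ (blocks-valid p q))
                   (label-next (blocks-valid p q) (trans (sum-blocks p q) length≡))
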